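{- Let $b\ge1$ and consider a sequence of steps with bounded average rate $b$ of mixing steps, as described in the context. Then for any $m\ge(b+1)\,n$, among any $m$ consecutive steps at least a $\frac{1}{4(b+1)}$ fraction are sorting steps.
   Context: $n\ge2$. The steps $1,2,3,\dots$ are each of one of two types, sorting or mixing, arranged as follows: a sorting step, then $b_1$ mixing steps, then a sorting step, then $b_2$ mixing steps, and so on, where $b_i\ge0$ is the number of mixing steps between the $i$-th and $(i+1)$-th sorting steps. Bounded average rate $b$ means $\sum_{i=t+1}^{t+n}b_i\le b\cdot n$ for all integers $t\ge0$.
   Formalization: The bound b on the average rate of mixing steps ranges over the rationals. -}

module Defs where

open import Data.Nat using (ℕ; zero; suc; _+_; _≡ᵇ_)
open import Data.Bool using (Bool; if_then_else_)
open import Data.List using (List; upTo; map; applyUpTo)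
open import Data.Bool.ListAction using (any)
open import Data.Nat.ListAction using (sum)
open import Data.Integer using (+_)
open import Data.Rational using (ℚ; _/_)

-- Mixing-step counts: β i = b_{i+1}, i.e. β 0 = b_1, β 1 = b_2, ...
-- Steps are numbered 1,2,3,...

-- Position of the (k+1)-th sorting step (k = 0,1,2,...):
-- step 1 is sorting, then b_1 mixing steps, then a sorting step, ...
sortPos : (ℕ → ℕ) → ℕ → ℕ
sortPos β zero    = 1
sortPos β (suc k) = sortPos β k + β k + 1

-- Step s is a sorting step iff s = sortPos β k for some k
-- (necessarily k < s, since sortPos β k ≥ k + 1).
isSorting : (ℕ → ℕ) → ℕ → Bool
isSorting β s = any (λ k → sortPos β k ≡ᵇ s) (upTo (suc s))

sortingCount : (ℕ → ℕ) → ℕ → ℕ → ℕ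
sortingCount β j m =
  sum (map (λ s → if isSorting β s then 1 else 0) (applyUpTo (λ i → j + suc i) m))

-- Σ_{i=t+1}^{t+n} b_i  =  β t + ... + β (t+n-1)
windowSum : (ℕ → ℕ) → ℕ → ℕ → ℕ
windowSum β t n = sum (map β (applyUpTo (λ i → t + i) n))

toℚ : ℕ → ℚ
toℚ k = + k / 1

module Submission where

-- Split the steps into blocks, each a sorting step followed by its b_i mixing steps. A window of m
-- steps meeting c sorting steps lies inside c + 1 consecutive blocks, so m ≤ (c + 1) + (a sum of
-- c + 1 consecutive b_i). Covering those indices by ⌈(c + 1)/n⌉ runs of length n, the rate bound gives
-- m ≤ (c + 1) + b·n·⌈(c + 1)/n⌉. Together with m ≥ (b + 1)n this forces c + 1 ≥ n ≥ 2, and then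
-- both (c + 1) and n·⌈(c + 1)/n⌉ are at most 2c.

open import Defs

module SortingSteps where
  open import Data.Bool using (true; if_then_else_)
  open import Data.Bool.Properties using (T-≡)
  open import Data.List using (_∷_; applyUpTo; map)
  open import Data.List.Membership.Propositional using (lose)
  open import Data.List.Membership.Propositional.Properties using (∈-upTo⁺)
  open import Data.List.Relation.Unary.Any.Properties using (any⁺)
  open import Data.Nat using (ℕ; zero; suc; _+_; _≤_; _<_; s≤s; s≤s⁻¹; z<s)
  open import Data.Nat.Properties
  open import Data.Nat.ListAction using (sum)
  open import Data.Product using (∃; _×_; _,_)
  open import Data.Sum using (inj₁; inj₂)
  open import Function.Bundles using (module Equivalence)
  open import Relation.Binary.PropositionalEquality
  open import Function using (_∘_)
  open import Data.Nat.Tactic.RingSolver using (solve-∀)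

  applyUpTo-cong : ∀ {a} {A : Set a} {f g : ℕ → A} → (∀ i → f i ≡ g i) →
                   ∀ n → applyUpTo f n ≡ applyUpTo g n
  applyUpTo-cong f≗g zero    = refl
  applyUpTo-cong f≗g (suc n) = cong₂ _∷_ (f≗g 0) (applyUpTo-cong (λ i → f≗g (suc i)) n)

  module _ (β : ℕ → ℕ) where

    windowSum-suc : ∀ k L → windowSum β k (suc L) ≡ β k + windowSum β (suc k) L
    windowSum-suc k L = cong₂ _+_ (cong β (+-identityʳ k))
      (cong (sum ∘ map β) (applyUpTo-cong (+-suc k) L))

    windowSum-+ : ∀ k a L → windowSum β k (a + L) ≡ windowSum β k a + windowSum β (k + a) L
    windowSum-+ k zero    L = cong (λ i → windowSum β i L) (sym (+-identityʳ k))
    windowSum-+ k (suc a) L = begin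
      windowSum β k (suc a + L)                                    ≡⟨ windowSum-suc k (a + L) ⟩
      β k + windowSum β (suc k) (a + L)                            ≡⟨ cong (β k +_) (windowSum-+ (suc k) a L) ⟩
      β k + (windowSum β (suc k) a + windowSum β (suc k + a) L)    ≡⟨ +-assoc (β k) _ _ ⟨
      (β k + windowSum β (suc k) a) + windowSum β (suc k + a) L    ≡⟨ cong₂ _+_ (windowSum-suc k a)
                                                                      (cong (λ i → windowSum β i L) (+-suc k a)) ⟨
      windowSum β k (suc a) + windowSum β (k + suc a) L            ∎
      where open ≡-Reasoning

    windowSum-mono : ∀ k {L L′} → L ≤ L′ → windowSum β k L ≤ windowSum β k L′
    windowSum-mono k {L} L≤L′ with d , refl ← m≤n⇒∃[o]m+o≡n L≤L′ =
      subst (windowSum β k L ≤_) (sym (windowSum-+ k L d)) (m≤m+n _ _)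

    sortPos-+ : ∀ k L → sortPos β (k + L) ≡ sortPos β k + windowSum β k L + L
    sortPos-+ k zero    = trans (cong (sortPos β) (+-identityʳ k)) (sym (trans (+-identityʳ _) (+-identityʳ _)))
    sortPos-+ k (suc L) = begin
      sortPos β (k + suc L)                                  ≡⟨ cong (sortPos β) (+-suc k L) ⟩
      sortPos β (suc k + L)                                  ≡⟨ sortPos-+ (suc k) L ⟩
      sortPos β k + β k + 1 + windowSum β (suc k) L + L      ≡⟨ regroup (sortPos β k) (β k) _ L ⟩
      sortPos β k + (β k + windowSum β (suc k) L) + suc L    ≡⟨ cong (λ w → sortPos β k + w + suc L) (windowSum-suc k L) ⟨
      sortPos β k + windowSum β k (suc L) + suc L            ∎
      where
      open ≡-Reasoning
      regroup : ∀ p b w l → p + b + 1 + w + l ≡ p + (b + w) + suc l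
      regroup = solve-∀

    sortPos-< : ∀ k → sortPos β k < sortPos β (suc k)
    sortPos-< k = ≤-<-trans (m≤m+n (sortPos β k) (β k)) (m<m+n _ z<s)

    sortPos-mono : ∀ {k k′} → k ≤ k′ → sortPos β k ≤ sortPos β k′
    sortPos-mono {k} k≤k′ with d , refl ← m≤n⇒∃[o]m+o≡n k≤k′ =
      subst (sortPos β k ≤_) (sym (sortPos-+ k d)) (≤-trans (m≤m+n _ _) (m≤m+n _ _))

    <-sortPos : ∀ k → k < sortPos β k
    <-sortPos k = subst (k <_) (sym (sortPos-+ 0 k)) (s≤s (m≤n+m k _))

    isSorting-sortPos : ∀ k → isSorting β (sortPos β k) ≡ true
    isSorting-sortPos k = Equivalence.to T-≡
      (any⁺ _ (lose (∈-upTo⁺ (m<n⇒m<1+n (<-sortPos k))) (≡⇒≡ᵇ (sortPos β k) _ refl)))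

    sortingCount-suc : ∀ j m → sortingCount β j (suc m) ≡
                       (if isSorting β (suc j) then 1 else 0) + sortingCount β (suc j) m
    sortingCount-suc j m = cong₂ _+_ (cong indicator (+-comm j 1))
      (cong (sum ∘ map indicator) (applyUpTo-cong (λ i → +-suc j (suc i)) m))
      where
      indicator : ℕ → ℕ
      indicator s = if isSorting β s then 1 else 0

    sortPos-bracket : ∀ j → ∃ λ k → sortPos β k ≤ suc j × suc j < sortPos β (suc k)
    sortPos-bracket zero    = 0 , ≤-refl , sortPos-< 0
    sortPos-bracket (suc j) with k , P≤ , <P ← sortPos-bracket j with m≤n⇒m<n∨m≡n <P
    ... | inj₁ 2+j<P = k , m≤n⇒m≤1+n P≤ , 2+j<P
    ... | inj₂ 2+j≡P = suc k , ≤-reflexive (sym 2+j≡P) ,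
                       subst (_< sortPos β (suc (suc k))) (sym 2+j≡P) (sortPos-< (suc k))

    sortPos-beyond-window : ∀ m j k → j < sortPos β k → j + m < sortPos β (k + sortingCount β j m)
    sortPos-beyond-window zero    j k j<P =
      subst₂ _<_ (sym (+-identityʳ j)) (cong (sortPos β) (sym (+-identityʳ k))) j<P
    sortPos-beyond-window (suc m) j k j<P with m≤n⇒m<n∨m≡n j<P
    ... | inj₁ 1+j<P = begin-strict
      j + suc m                                        ≡⟨ +-suc j m ⟩
      suc j + m                                        <⟨ sortPos-beyond-window m (suc j) k 1+j<P ⟩
      sortPos β (k + sortingCount β (suc j) m)          ≤⟨ sortPos-mono (+-monoʳ-≤ k count≤) ⟩
      sortPos β (k + sortingCount β j (suc m))          ∎
      where
      open ≤-Reasoning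
      count≤ : sortingCount β (suc j) m ≤ sortingCount β j (suc m)
      count≤ = subst (sortingCount β (suc j) m ≤_) (sym (sortingCount-suc j m)) (m≤n+m _ _)
    ... | inj₂ 1+j≡P = begin-strict
      j + suc m                                        ≡⟨ +-suc j m ⟩
      suc j + m                                        <⟨ sortPos-beyond-window m (suc j) (suc k) 1+j<P′ ⟩
      sortPos β (suc k + sortingCount β (suc j) m)      ≡⟨ cong (sortPos β) (+-suc k _) ⟨
      sortPos β (k + suc (sortingCount β (suc j) m))    ≡⟨ cong (λ c → sortPos β (k + c)) count≡ ⟨
      sortPos β (k + sortingCount β j (suc m))          ∎
      where
      open ≤-Reasoning
      1+j<P′ : suc j < sortPos β (suc k)
      1+j<P′ = subst (_< sortPos β (suc k)) (sym 1+j≡P) (sortPos-< k)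
      count≡ : sortingCount β j (suc m) ≡ suc (sortingCount β (suc j) m)
      count≡ = trans (sortingCount-suc j m) (cong (λ b → (if b then 1 else 0) + sortingCount β (suc j) m)
        (trans (cong (isSorting β) 1+j≡P) (isSorting-sortPos k)))

    -- The blocks start at the last sorting step at or before step j (at the first one if j = 0);
    -- the window ends before sortPos β (k + c + 1).
    window≤blocks : ∀ j m → ∃ λ k →
      m ≤ suc (sortingCount β j m) + windowSum β k (suc (sortingCount β j m))
    window≤blocks zero m = 0 , (begin
      m                                     ≤⟨ s≤s⁻¹ (subst (m <_) (sortPos-+ 0 c) (sortPos-beyond-window m 0 0 z<s)) ⟩
      windowSum β 0 c + c                   ≤⟨ +-mono-≤ (windowSum-mono 0 (n≤1+n c)) (n≤1+n c) ⟩
      windowSum β 0 (suc c) + suc c         ≡⟨ +-comm _ (suc c) ⟩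
      suc c + windowSum β 0 (suc c)         ∎)
      where
      open ≤-Reasoning
      c : ℕ
      c = sortingCount β 0 m
    window≤blocks (suc j) m with k , P≤ , <P ← sortPos-bracket j =
      k , <⇒≤ (+-cancelˡ-< (sortPos β k) m _ (begin-strict
      sortPos β k + m                                  ≤⟨ +-monoˡ-≤ m P≤ ⟩
      suc j + m                                        <⟨ sortPos-beyond-window m (suc j) (suc k) <P ⟩
      sortPos β (suc k + c)                            ≡⟨ cong (sortPos β) (+-suc k c) ⟨
      sortPos β (k + suc c)                            ≡⟨ sortPos-+ k (suc c) ⟩
      sortPos β k + windowSum β k (suc c) + suc c      ≡⟨ +-assoc (sortPos β k) _ _ ⟩
      sortPos β k + (windowSum β k (suc c) + suc c)    ≡⟨ cong (sortPos β k +_) (+-comm _ (suc c)) ⟩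
      sortPos β k + (suc c + windowSum β k (suc c))    ∎))
      where
      open ≤-Reasoning
      c : ℕ
      c = sortingCount β (suc j) m

module NaturalEmbedding where
  import Data.Nat as ℕ
  open import Data.Integer as ℤ using (+_)
  import Data.Integer.Properties as ℤ
  open import Data.Rational
  open import Data.Rational.Properties
  open import Data.Rational.Unnormalised as ℚᵘ using (mkℚᵘ; *≡*)
  import Data.Rational.Unnormalised.Properties as ℚᵘ
  open import Relation.Binary.PropositionalEquality using (_≡_; cong; cong₂; trans; sym)

  -- toℚ k unfolds to fromℚᵘ (mkℚᵘ (+ k) 0).
  toℚᵘ-toℚ : ∀ k → toℚᵘ (toℚ k) ℚᵘ.≃ mkℚᵘ (+ k) 0
  toℚᵘ-toℚ k = toℚᵘ-fromℚᵘ (mkℚᵘ (+ k) 0)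

  toℚ-+ : ∀ a b → toℚ (a ℕ.+ b) ≡ toℚ a + toℚ b
  toℚ-+ a b = toℚᵘ-injective (begin-equality
    toℚᵘ (toℚ (a ℕ.+ b))                 ≃⟨ toℚᵘ-toℚ (a ℕ.+ b) ⟩
    mkℚᵘ (+ (a ℕ.+ b)) 0                 ≃⟨ *≡* (cong (ℤ._* ℤ.1ℤ) numerators) ⟩
    mkℚᵘ (+ a) 0 ℚᵘ.+ mkℚᵘ (+ b) 0      ≃⟨ ℚᵘ.+-cong (toℚᵘ-toℚ a) (toℚᵘ-toℚ b) ⟨
    toℚᵘ (toℚ a) ℚᵘ.+ toℚᵘ (toℚ b)      ≃⟨ toℚᵘ-homo-+ (toℚ a) (toℚ b) ⟨
    toℚᵘ (toℚ a + toℚ b)                 ∎)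
    where
    open ℚᵘ.≤-Reasoning
    numerators : + (a ℕ.+ b) ≡ + a ℤ.* ℤ.1ℤ ℤ.+ + b ℤ.* ℤ.1ℤ
    numerators = trans (ℤ.pos-+ a b) (sym (cong₂ ℤ._+_ (ℤ.*-identityʳ (+ a)) (ℤ.*-identityʳ (+ b))))

  toℚ-* : ∀ a b → toℚ (a ℕ.* b) ≡ toℚ a * toℚ b
  toℚ-* a b = toℚᵘ-injective (begin-equality
    toℚᵘ (toℚ (a ℕ.* b))                 ≃⟨ toℚᵘ-toℚ (a ℕ.* b) ⟩
    mkℚᵘ (+ (a ℕ.* b)) 0                 ≃⟨ *≡* (cong (ℤ._* ℤ.1ℤ) (ℤ.pos-* a b)) ⟩
    mkℚᵘ (+ a) 0 ℚᵘ.* mkℚᵘ (+ b) 0      ≃⟨ ℚᵘ.*-cong (toℚᵘ-toℚ a) (toℚᵘ-toℚ b) ⟨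
    toℚᵘ (toℚ a) ℚᵘ.* toℚᵘ (toℚ b)      ≃⟨ toℚᵘ-homo-* (toℚ a) (toℚ b) ⟨
    toℚᵘ (toℚ a * toℚ b)                 ∎)
    where open ℚᵘ.≤-Reasoning

  toℚ-mono-≤ : ∀ {a b} → a ℕ.≤ b → toℚ a ≤ toℚ b
  toℚ-mono-≤ {a} {b} a≤b = toℚᵘ-cancel-≤ (begin
    toℚᵘ (toℚ a)      ≃⟨ toℚᵘ-toℚ a ⟩
    mkℚᵘ (+ a) 0      ≤⟨ ℚᵘ.*≤* (ℤ.*-monoʳ-≤-nonNeg ℤ.1ℤ (ℤ.+≤+ a≤b)) ⟩
    mkℚᵘ (+ b) 0      ≃⟨ toℚᵘ-toℚ b ⟨
    toℚᵘ (toℚ b)      ∎)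
    where open ℚᵘ.≤-Reasoning

  toℚ-mono-< : ∀ {a b} → a ℕ.< b → toℚ a < toℚ b
  toℚ-mono-< {a} {b} a<b = toℚᵘ-cancel-< (begin-strict
    toℚᵘ (toℚ a)      ≃⟨ toℚᵘ-toℚ a ⟩
    mkℚᵘ (+ a) 0      <⟨ ℚᵘ.*<* (ℤ.*-monoʳ-<-pos ℤ.1ℤ (ℤ.+<+ a<b)) ⟩
    mkℚᵘ (+ b) 0      ≃⟨ toℚᵘ-toℚ b ⟨
    toℚᵘ (toℚ b)      ∎)
    where open ℚᵘ.≤-Reasoning

  m≤X+w∧w≤y⇒m≤X+y : ∀ {m} X w {y} → m ℕ.≤ X ℕ.+ w → toℚ w ≤ y → toℚ m ≤ toℚ X + y
  m≤X+w∧w≤y⇒m≤X+y X w m≤X+w w≤y = ≤-trans (toℚ-mono-≤ m≤X+w)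
    (≤-trans (≤-reflexive (toℚ-+ X w)) (+-monoʳ-≤ (toℚ X) w≤y))

module RateBounds where
  open import Data.Nat as ℕ using (ℕ; zero; suc; NonZero)
  import Data.Nat.Properties as ℕ
  open import Data.Nat.DivMod using (_/_; m≡m%n+[m/n]*n; m%n<n; m/n*n≤m)
  open import Data.Product using (∃; _×_; _,_)
  open import Data.Rational using (ℚ; _+_; _*_; _≤_; 1ℚ; NonNegative)
  open import Data.Rational.Properties
  open import Data.Rational.Solver using (module +-*-Solver)
  open import Relation.Binary.PropositionalEquality using (refl; cong; sym; subst)
  open SortingSteps
  open NaturalEmbedding
  open +-*-Solver

  ∃[q]1+c≤q*n≤c+c : ∀ {n c} .{{_ : NonZero n}} → n ℕ.≤ c →
                    ∃ λ q → suc c ℕ.≤ q ℕ.* n × q ℕ.* n ℕ.≤ c ℕ.+ c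
  ∃[q]1+c≤q*n≤c+c {n} {c} n≤c = suc (c / n) ,
    subst (λ x → suc x ℕ.≤ n ℕ.+ c / n ℕ.* n) (sym (m≡m%n+[m/n]*n c n)) (ℕ.+-monoˡ-≤ _ (m%n<n c n)) ,
    ℕ.+-mono-≤ n≤c (m/n*n≤m c n)

  [b+1]n≤X+bn⇒n≤X : ∀ b n X → (b + 1ℚ) * toℚ n ≤ toℚ X + b * toℚ n → n ℕ.≤ X
  [b+1]n≤X+bn⇒n≤X b n X ≤X+bn = ℕ.≮⇒≥ λ X<n → <-irrefl refl (<-≤-trans (begin-strict
    toℚ X + b * toℚ n    <⟨ +-monoˡ-< (b * toℚ n) (toℚ-mono-< X<n) ⟩
    toℚ n + b * toℚ n    ≡⟨ solve 2 (λ N B → N :+ B :* N := (B :+ con 1ℚ) :* N) refl (toℚ n) b ⟩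
    (b + 1ℚ) * toℚ n     ∎) ≤X+bn)
    where open ≤-Reasoning

  ≤X+bY⇒≤4[b+1]c : ∀ b .{{_ : NonNegative b}} m X Y c → toℚ m ≤ toℚ X + b * toℚ Y →
                   X ℕ.≤ c ℕ.+ c → Y ℕ.≤ c ℕ.+ c → toℚ m ≤ toℚ 4 * (b + 1ℚ) * toℚ c
  ≤X+bY⇒≤4[b+1]c b m X Y c m≤X+bY X≤2c Y≤2c = begin
    toℚ m                                     ≤⟨ m≤X+bY ⟩
    toℚ X + b * toℚ Y                         ≤⟨ +-mono-≤ (toℚ-mono-≤ (≤4c X≤2c))
                                                     (*-monoˡ-≤-nonNeg b (toℚ-mono-≤ (≤4c Y≤2c))) ⟩
    toℚ (4 ℕ.* c) + b * toℚ (4 ℕ.* c)         ≡⟨ cong (λ x → x + b * x) (toℚ-* 4 c) ⟩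
    toℚ 4 * toℚ c + b * (toℚ 4 * toℚ c)       ≡⟨ solve 3 (λ F C B → F :* C :+ B :* (F :* C) := F :* (B :+ con 1ℚ) :* C)
                                                    refl (toℚ 4) (toℚ c) b ⟩
    toℚ 4 * (b + 1ℚ) * toℚ c                  ∎
    where
    open ≤-Reasoning
    ≤4c : ∀ {Z} → Z ℕ.≤ c ℕ.+ c → Z ℕ.≤ 4 ℕ.* c
    ≤4c Z≤2c = ℕ.≤-trans Z≤2c (ℕ.+-monoʳ-≤ c (ℕ.m≤m+n c _))

  module _ (β : ℕ → ℕ) (n : ℕ) (b : ℚ) .{{_ : NonNegative b}}
           (rate : ∀ t → toℚ (windowSum β t n) ≤ b * toℚ n) where

    windowSum-≤-rate : ∀ k {L} → L ℕ.≤ n → toℚ (windowSum β k L) ≤ b * toℚ n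
    windowSum-≤-rate k L≤n = ≤-trans (toℚ-mono-≤ (windowSum-mono β k L≤n)) (rate k)

    windowSum-≤-blocks : ∀ q k {L} → L ℕ.≤ q ℕ.* n → toℚ (windowSum β k L) ≤ b * toℚ (q ℕ.* n)
    windowSum-≤-blocks zero    k ℕ.z≤n = ≤-reflexive (sym (*-zeroʳ b))
    windowSum-≤-blocks (suc q) k {L} L≤ = begin
      toℚ (windowSum β k L)                                          ≤⟨ toℚ-mono-≤ (windowSum-mono β k L≤) ⟩
      toℚ (windowSum β k (n ℕ.+ q ℕ.* n))                             ≡⟨ cong toℚ (windowSum-+ β k n (q ℕ.* n)) ⟩
      toℚ (windowSum β k n ℕ.+ windowSum β (k ℕ.+ n) (q ℕ.* n))       ≡⟨ toℚ-+ (windowSum β k n) _ ⟩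
      toℚ (windowSum β k n) + toℚ (windowSum β (k ℕ.+ n) (q ℕ.* n))   ≤⟨ +-mono-≤ (rate k) (windowSum-≤-blocks q _ ℕ.≤-refl) ⟩
      b * toℚ n + b * toℚ (q ℕ.* n)                                   ≡⟨ *-distribˡ-+ b _ _ ⟨
      b * (toℚ n + toℚ (q ℕ.* n))                                     ≡⟨ cong (b *_) (toℚ-+ n (q ℕ.* n)) ⟨
      b * toℚ (suc q ℕ.* n)                                           ∎
      where open ≤-Reasoning

open import Data.Nat as ℕ using (ℕ; _≥_; suc)
import Data.Nat.Properties as ℕ
open import Data.Rational using (ℚ; _≤_; _+_; _*_; 1ℚ; NonNegative; nonNegative)
open import Data.Product using (_,_; proj₁; proj₂)
open import Data.Rational.Properties using (≤-trans; nonNegative⁻¹)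
open import Relation.Nullary using (Dec; yes; no)
open SortingSteps
open NaturalEmbedding
open RateBounds

lemma5p8 : (n : ℕ) → n ≥ 2 → (β : ℕ → ℕ) → (b : ℚ) → 1ℚ ≤ b →
    (∀ t → toℚ (windowSum β t n) ≤ b * toℚ n) →
    ∀ m → (b + 1ℚ) * toℚ n ≤ toℚ m →
    ∀ j → toℚ m ≤ toℚ 4 * (b + 1ℚ) * toℚ (sortingCount β j m)
lemma5p8 n n≥2 β b 1≤b rate m [b+1]n≤m j = bound (n ℕ.≤? c)
  where
  c : ℕ
  c = sortingCount β j m
  0<n : 0 ℕ.< n
  0<n = ℕ.≤-trans (ℕ.s≤s ℕ.z≤n) n≥2
  instance
    n≢0 : ℕ.NonZero n
    n≢0 = ℕ.>-nonZero 0<n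
    b≥0 : NonNegative b
    b≥0 = nonNegative (≤-trans (nonNegative⁻¹ 1ℚ) 1≤b)
  k : ℕ
  k = proj₁ (window≤blocks β j m)
  m≤blocks : m ℕ.≤ suc c ℕ.+ windowSum β k (suc c)
  m≤blocks = proj₂ (window≤blocks β j m)
  m≤1+c+b : ∀ {y} → toℚ (windowSum β k (suc c)) ≤ y → toℚ m ≤ toℚ (suc c) + y
  m≤1+c+b = m≤X+w∧w≤y⇒m≤X+y (suc c) (windowSum β k (suc c)) m≤blocks
  bound : Dec (n ℕ.≤ c) → toℚ m ≤ toℚ 4 * (b + 1ℚ) * toℚ c
  bound (yes n≤c) with q , 1+c≤qn , qn≤2c ← ∃[q]1+c≤q*n≤c+c n≤c =
    ≤X+bY⇒≤4[b+1]c b m (suc c) (q ℕ.* n) c (m≤1+c+b (windowSum-≤-blocks β n b rate q k 1+c≤qn))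
      (ℕ.+-monoˡ-≤ c (ℕ.≤-trans 0<n n≤c)) qn≤2c
  bound (no c≱n) = ≤X+bY⇒≤4[b+1]c b m (suc c) n c m≤1+c+bn 1+c≤2c (ℕ.≤-trans n≤1+c 1+c≤2c)
    where
    m≤1+c+bn : toℚ m ≤ toℚ (suc c) + b * toℚ n
    m≤1+c+bn = m≤1+c+b (windowSum-≤-rate β n b rate k (ℕ.≰⇒> c≱n))
    n≤1+c : n ℕ.≤ suc c
    n≤1+c = [b+1]n≤X+bn⇒n≤X b n (suc c) (≤-trans [b+1]n≤m m≤1+c+bn)
    1+c≤2c : suc c ℕ.≤ c ℕ.+ c
    1+c≤2c = ℕ.+-monoˡ-≤ c (ℕ.s≤s⁻¹ (ℕ.≤-trans n≥2 n≤1+c))
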